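{- Let $k\geq 1$ be an integer, let $q\equiv 2k+1 \pmod{4k}$ be a prime power, and let $V=V_0\cup V_1\cup\dots\cup V_{k-1}$ be a cyclotomic half-set of $\mathbb{F}_q$ of order $2k$ (with $V_i=(-1)^{\alpha_i}C^{2k}_i$ as in the context). If there exists a $(V,k,r)$ Heffter difference matrix, then there exists a $(\frac{q-1}{2},k;r)$ Heffter space. If the matrix is simple, the Heffter space is simple as well.
   Context: Let $g$ be a fixed primitive element of $\mathbb{F}_q$. $C^{2k}$ denotes the subgroup of index $2k$ of $\mathbb{F}_q^*$, and $C^{2k}_i=g^iC^{2k}$ for $0\le i\le 2k-1$ (the cyclotomic classes of order $2k$). Since $q\equiv 2k+1 \pmod{4k}$, $-1\in C^{2k}_k$. A cyclotomic half-set of $\mathbb{F}_q$ of order $2k$ is a set $V=\bigcup_{i=0}^{k-1}(-1)^{\alpha_i}C^{2k}_i$ with $\alpha_i\in\{0,1\}$; one writes $V_i=(-1)^{\alpha_i}C^{2k}_i$ and assumes $\alpha_0=0$. A $(V,k,r)$ Heffter difference matrix is an $r\times k$ matrix $B=(b_{h,i})$ (rows indexed $1,\dots,r$, columns $0,\dots,k-1$) with entries in $\mathbb{F}_q$ such that: (i) every row is zero-sum in $\mathbb{F}_q$; (ii) every entry of column $i$ lies in $V_i$, for $0\le i\le k-1$; (iii) for $0\le i<j\le k-1$ the multiset $\{b_{h,i}/b_{h,j} : 1\le h\le r\}$ has no repeated elements. It is simple if, for each row $(b_{h,0},\dots,b_{h,k-1})$, the partial sums $b_{h,0}, b_{h,0}+b_{h,1},\dots,b_{h,0}+\dots+b_{h,k-1}$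 are pairwise distinct. A $(v_r,b_k)$ configuration is a point-block incidence structure $(V,\mathcal{B})$ with $v$ points and $b$ blocks, each block a $k$-subset, any two distinct points in at most one common block, every point in exactly $r$ blocks; it is resolvable if $\mathcal{B}$ partitions into $r$ parallel classes, each a partition of $V$. A half-set of an abelian group $G$ is $V\subseteq G$ with $V$ and $-V$ partitioning $G\setminus\{0\}$. A $(v,k;r)$ Heffter space over an abelian group $G$ is a resolvable $(v_r,b_k)$ configuration whose point set is a half-set of $G$ and whose blocks are all zero-sum in $G$. It is simple if every block can be ordered so that its partial sums are pairwise distinct. -}

module Defs where

open import Data.Nat using (ℕ; zero; suc; _+_; _*_; _∸_; _^_; _≤_; _<_)
open import Data.Nat.Primality using (Prime)
open import Data.Fin using (Fin; toℕ; fromℕ<)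
import Data.Fin as Fin
open import Data.Bool using (Bool; true; false; if_then_else_)
open import Data.Product using (Σ; ∃; _×_; _,_)
open import Data.Sum using (_⊎_)
open import Relation.Binary.PropositionalEquality using (_≡_; _≢_)
open import Relation.Nullary using (¬_)
open import Function.Bundles using (Inverse; _↔_)
open import Function.Definitions using (Injective)
open import Algebra.Structures using (IsCommutativeRing)

IsPrimePower : ℕ → Set
IsPrimePower q = Σ ℕ λ p → Σ ℕ λ e → Prime p × 1 ≤ e × q ≡ p ^ e

record FiniteField (q : ℕ) : Set₁ where
  infixl 6 _+F_
  infixl 7 _*F_
  field
    F       : Set
    0F 1F   : F
    _+F_    : F → F → F
    _*F_    : F → F → F
    -F_     : F → F
    _⁻¹     : F → F
    isCommRing : IsCommutativeRing _≡_ _+F_ _*F_ -F_ 0F 1F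
    0≢1     : 0F ≢ 1F
    inverseʳ : ∀ x → x ≢ 0F → x *F (x ⁻¹) ≡ 1F
    enum    : Fin q ↔ F

module FF {q : ℕ} (𝔽 : FiniteField q) where
  open FiniteField 𝔽 public

  _^F_ : F → ℕ → F
  x ^F zero  = 1F
  x ^F suc n = x *F (x ^F n)

  sumF : ∀ {n} → (Fin n → F) → F
  sumF {zero}  f = 0F
  sumF {suc n} f = f Fin.zero +F sumF (λ i → f (Fin.suc i))

  partialSum : ∀ {n} → (Fin n → F) → Fin n → F
  partialSum {suc n} f Fin.zero    = f Fin.zero
  partialSum {suc n} f (Fin.suc m) = f Fin.zero +F partialSum (λ i → f (Fin.suc i)) m

  Primitive : F → Set
  Primitive g = g ≢ 0F × (∀ x → x ≢ 0F → Σ ℕ λ n → g ^F n ≡ x)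

  -- cyclotomic class C^{2k}_i = g^i C^{2k}, where C^{2k} = ⟨g^{2k}⟩ (index-2k subgroup)
  InC : (g : F) (k i : ℕ) → F → Set
  InC g k i x = Σ ℕ λ m → x ≡ g ^F (i + 2 * k * m)

  sign : Bool → F → F
  sign b y = if b then -F y else y

  InV : (g : F) (k : ℕ) (α : Fin k → Bool) → Fin k → F → Set
  InV g k α i x = Σ F λ y → InC g k (toℕ i) y × x ≡ sign (α i) y

  record HDM (g : F) (k : ℕ) (α : Fin k → Bool) (r : ℕ) : Set where
    field
      B        : Fin r → Fin k → F
      zeroSum  : ∀ h → sumF (B h) ≡ 0F
      inCol    : ∀ h i → InV g k α i (B h i)
      ratios   : ∀ (i j : Fin k) → toℕ i < toℕ j → ∀ (h h' : Fin r) → h ≢ h' →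
                   B h i *F (B h j ⁻¹) ≢ B h' i *F (B h' j ⁻¹)

  SimpleHDM : ∀ {g k α r} → HDM g k α r → Set
  SimpleHDM {k = k} {r = r} M = ∀ (h : Fin r) → Injective _≡_ _≡_ (partialSum (HDM.B M h))

  -- (v,k;r) Heffter space over the additive group (F,+):
  -- points: an injective family pts : Fin v → F whose image is a half-set of F;
  -- blocks: r parallel classes, each consisting of m blocks; a block is an
  -- injective k-tuple of points (its underlying set is its image).
  record HeffterSpace (v k r : ℕ) : Set where
    field
      pts       : Fin v → F
      pts-inj   : Injective _≡_ _≡_ pts
      half-0    : ∀ a → pts a ≢ 0F
      half-cov  : ∀ x → x ≢ 0F → (Σ (Fin v) λ a → pts a ≡ x) ⊎ (Σ (Fin v) λ a → pts a ≡ -F x)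
      half-disj : ∀ a b → pts a ≢ -F (pts b)
      m         : ℕ
      blk       : Fin r → Fin m → Fin k → F
      blk-pt    : ∀ c j l → Σ (Fin v) λ a → pts a ≡ blk c j l
      blk-inj   : ∀ c j → Injective _≡_ _≡_ (blk c j)
      cls-cov   : ∀ c a → Σ (Fin m) λ j → Σ (Fin k) λ l → blk c j l ≡ pts a
      cls-disj  : ∀ c j j' l l' → blk c j l ≡ blk c j' l' → j ≡ j'
      -- two distinct points lie in at most one common block
      config    : ∀ c j c' j' → ¬ (c ≡ c' × j ≡ j') → ∀ x y → x ≢ y →
                    ¬ ((Σ (Fin k) λ l → blk c j l ≡ x) × (Σ (Fin k) λ l → blk c j l ≡ y) ×
                       (Σ (Fin k) λ l → blk c' j' l ≡ x) × (Σ (Fin k) λ l → blk c' j' l ≡ y))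
      zeroSum   : ∀ c j → sumF (blk c j) ≡ 0F

  SimpleHS : ∀ {v k r} → HeffterSpace v k r → Set
  SimpleHS {k = k} {r = r} H =
    ∀ c j → Σ (Fin k ↔ Fin k) λ σ →
      Injective _≡_ _≡_ (partialSum (λ l → HeffterSpace.blk H c j (Inverse.to σ l)))

{-# OPTIONS --safe #-}
module Submission where

-- Write q = 1 + 2km with m = 2t + 1 odd. Then −1 = g^(km) lies in the class C^{2k}_k, so
-- negation moves C^{2k}_i to C^{2k}_{i+k}: the sets V_i = ±g^i C^{2k} (i < k) form a
-- half-set V of size km, and every element of V_i is g^(i+2ks) up to the sign (−1)^{α_i}.
-- The h-th parallel class consists of the m translates g^(2kj) B_h (j < m) of the h-th row:
-- column l of each translate stays in V_l and these translates run through C^{2k}, so the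
-- class partitions V. If two blocks share points from columns l ≠ l′, both come from rows
-- with the same ratio b_{h,l}/b_{h,l′}, so condition (iii) makes them the same row and then
-- the same translate. Scaling preserves zero sums and distinctness of partial sums.

open import Defs
open import Algebra.Bundles using (CommutativeRing)
import Algebra.Properties.CommutativeSemigroup as CommutativeSemigroupProperties
import Algebra.Properties.Ring as RingProperties
open import Algebra.Structures using (IsCommutativeRing)
open import Data.Bool using (Bool; true; false; not)
open import Data.Bool.Properties using (not-¬)
open import Data.Empty using (⊥-elim)
open import Data.Fin as Fin using (Fin; toℕ; fromℕ<)
import Data.Fin.Properties as Fin
open import Data.Nat as ℕ using (ℕ; zero; suc; _+_; _*_; _∸_; _/_; _%_; _≤_; _<_; NonZero; z≤n; s≤s)
open import Data.Nat.DivMod using (m≡m%n+[m/n]*n; m%n<n; [m+kn]%n≡m%n; m<n⇒m%n≡m; m∣n⇒o%n%m≡o%m; m*n/n≡m)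
open import Data.Nat.Divisibility using (_∣_; m∣m*n)
import Data.Nat.Properties as ℕ
open import Data.Nat.Tactic.RingSolver using (solve-∀)
open import Data.Product using (Σ; _×_; _,_; proj₁; proj₂)
open import Data.Sum as Sum using (_⊎_; inj₁; inj₂)
open import Function.Base using (_∘_)
open import Function.Bundles using (Inverse; Injection)
open import Function.Construct.Identity using (↔-id)
open import Function.Construct.Symmetry using (↔-sym)
open import Function.Definitions using (Injective)
open import Function.Properties.Inverse using (↔⇒↣)
open import Relation.Binary.Definitions using (DecidableEquality; tri<; tri≈; tri>)
open import Relation.Binary.PropositionalEquality
  using (_≡_; _≢_; refl; sym; trans; cong; cong₂; subst; module ≡-Reasoning)
open import Relation.Nullary using (¬_; Dec; yes; no; ¬?)
open import Relation.Nullary.Decidable using (decidable-stable)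

module FieldProperties {q : ℕ} (𝔽 : FiniteField q) where
  open FF 𝔽
  open IsCommutativeRing isCommRing
    using (*-comm; *-assoc; *-identityˡ; *-identityʳ; zeroʳ; distribˡ; distribʳ; +-comm)
  open ≡-Reasoning

  commutativeRing : CommutativeRing _ _
  commutativeRing = record { isCommutativeRing = isCommRing }

  open RingProperties (CommutativeRing.ring commutativeRing)
    using (-‿involutive; -‿injective; -0#≈0#; -‿distribʳ-*; +-inverseˡ-unique)
  open CommutativeSemigroupProperties (CommutativeRing.*-commutativeSemigroup commutativeRing)
    using (interchange)

  _≟_ : DecidableEquality F
  _≟_ = Fin.inj⇒≟ (↔⇒↣ (↔-sym enum))

  *-cancelˡ : ∀ {z x y} → z ≢ 0F → z *F x ≡ z *F y → x ≡ y
  *-cancelˡ {z} {x} {y} z≢0 zx≡zy = begin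
    x                   ≡⟨ sym (*-identityˡ x) ⟩
    1F *F x             ≡⟨ cong (_*F x) z⁻¹z≡1 ⟨
    (z ⁻¹ *F z) *F x    ≡⟨ *-assoc _ _ _ ⟩
    z ⁻¹ *F (z *F x)    ≡⟨ cong (z ⁻¹ *F_) zx≡zy ⟩
    z ⁻¹ *F (z *F y)    ≡⟨ *-assoc _ _ _ ⟨
    (z ⁻¹ *F z) *F y    ≡⟨ cong (_*F y) z⁻¹z≡1 ⟩
    1F *F y             ≡⟨ *-identityˡ y ⟩
    y                   ∎
    where z⁻¹z≡1 = trans (*-comm _ _) (inverseʳ z z≢0)

  *-cancelʳ : ∀ {z x y} → z ≢ 0F → x *F z ≡ y *F z → x ≡ y
  *-cancelʳ {z} {x} {y} z≢0 xz≡yz = *-cancelˡ z≢0 (trans (*-comm z x) (trans xz≡yz (*-comm y z)))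

  x*y≢0 : ∀ {x y} → x ≢ 0F → y ≢ 0F → x *F y ≢ 0F
  x*y≢0 {x} {y} x≢0 y≢0 xy≡0 = y≢0 (*-cancelˡ x≢0 (trans xy≡0 (sym (zeroʳ x))))

  x⁻¹≢0 : ∀ {x} → x ≢ 0F → x ⁻¹ ≢ 0F
  x⁻¹≢0 {x} x≢0 x⁻¹≡0 = 0≢1 (trans (sym (zeroʳ x)) (trans (cong (x *F_) (sym x⁻¹≡0)) (inverseʳ x x≢0)))

  ⁻¹-unique : ∀ {x y} → x ≢ 0F → x *F y ≡ 1F → y ≡ x ⁻¹
  ⁻¹-unique x≢0 xy≡1 = *-cancelˡ x≢0 (trans xy≡1 (sym (inverseʳ _ x≢0)))

  ⁻¹-distrib-* : ∀ {x y} → x ≢ 0F → y ≢ 0F → (x *F y) ⁻¹ ≡ x ⁻¹ *F y ⁻¹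
  ⁻¹-distrib-* {x} {y} x≢0 y≢0 = sym (⁻¹-unique (x*y≢0 x≢0 y≢0) (begin
    (x *F y) *F (x ⁻¹ *F y ⁻¹)    ≡⟨ interchange x y (x ⁻¹) (y ⁻¹) ⟩
    (x *F x ⁻¹) *F (y *F y ⁻¹)    ≡⟨ cong₂ _*F_ (inverseʳ x x≢0) (inverseʳ y y≢0) ⟩
    1F *F 1F                      ≡⟨ *-identityˡ 1F ⟩
    1F                            ∎))

  ratio-*ˡ : ∀ {u a b} → u ≢ 0F → b ≢ 0F → (u *F a) *F (u *F b) ⁻¹ ≡ a *F b ⁻¹
  ratio-*ˡ {u} {a} {b} u≢0 b≢0 = begin
    (u *F a) *F (u *F b) ⁻¹       ≡⟨ cong ((u *F a) *F_) (⁻¹-distrib-* u≢0 b≢0) ⟩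
    (u *F a) *F (u ⁻¹ *F b ⁻¹)    ≡⟨ interchange u a (u ⁻¹) (b ⁻¹) ⟩
    (u *F u ⁻¹) *F (a *F b ⁻¹)    ≡⟨ cong (_*F (a *F b ⁻¹)) (inverseʳ u u≢0) ⟩
    1F *F (a *F b ⁻¹)             ≡⟨ *-identityˡ _ ⟩
    a *F b ⁻¹                     ∎

  -x≢0 : ∀ {x} → x ≢ 0F → -F x ≢ 0F
  -x≢0 x≢0 -x≡0 = x≢0 (-‿injective (trans -x≡0 (sym -0#≈0#)))

  x²≡1⇒x≡-1 : ∀ {x} → x *F x ≡ 1F → x ≢ 1F → x ≡ -F 1F
  x²≡1⇒x≡-1 {x} x²≡1 x≢1 with (x +F 1F) ≟ 0F
  ... | yes x+1≡0 = +-inverseˡ-unique x 1F x+1≡0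
  ... | no  x+1≢0 = ⊥-elim (x≢1 (*-cancelˡ x+1≢0 (begin
    (x +F 1F) *F x         ≡⟨ distribʳ x x 1F ⟩
    x *F x +F 1F *F x      ≡⟨ cong₂ _+F_ x²≡1 (*-identityˡ x) ⟩
    1F +F x                ≡⟨ +-comm 1F x ⟩
    x +F 1F                ≡⟨ *-identityʳ _ ⟨
    (x +F 1F) *F 1F        ∎)))

  sign≢0 : ∀ b {x} → x ≢ 0F → sign b x ≢ 0F
  sign≢0 true  = -x≢0
  sign≢0 false = λ x≢0 → x≢0

  sign-injective : ∀ b {x y} → sign b x ≡ sign b y → x ≡ y
  sign-injective true  = -‿injective
  sign-injective false = λ x≡y → x≡y

  *-sign : ∀ b u y → u *F sign b y ≡ sign b (u *F y)
  *-sign true  u y = sym (-‿distribʳ-* u y)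
  *-sign false u y = refl

  -‿sign : ∀ b y → -F sign b y ≡ sign (not b) y
  -‿sign true  y = -‿involutive y
  -‿sign false y = refl

  sign-cases : ∀ b c y → sign c y ≡ sign b y ⊎ sign c y ≡ -F sign b y
  sign-cases false false y = inj₁ refl
  sign-cases true  true  y = inj₁ refl
  sign-cases false true  y = inj₂ refl
  sign-cases true  false y = inj₂ (sym (-‿involutive y))

  ^-+ : ∀ x a b → x ^F (a + b) ≡ x ^F a *F x ^F b
  ^-+ x zero    b = sym (*-identityˡ _)
  ^-+ x (suc a) b = trans (cong (x *F_) (^-+ x a b)) (sym (*-assoc _ _ _))

  ^≢0 : ∀ {x} → x ≢ 0F → ∀ n → x ^F n ≢ 0F
  ^≢0 x≢0 zero    1≡0 = 0≢1 (sym 1≡0)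
  ^≢0 x≢0 (suc n) = x*y≢0 x≢0 (^≢0 x≢0 n)

  ^-*-≡1 : ∀ {x N} → x ^F N ≡ 1F → ∀ c → x ^F (N * c) ≡ 1F
  ^-*-≡1 {x} {N} xᴺ≡1 zero    = cong (x ^F_) (ℕ.*-zeroʳ N)
  ^-*-≡1 {x} {N} xᴺ≡1 (suc c) = begin
    x ^F (N * suc c)                ≡⟨ cong (x ^F_) (ℕ.*-suc N c) ⟩
    x ^F (N + N * c)                ≡⟨ ^-+ x N (N * c) ⟩
    x ^F N *F x ^F (N * c)          ≡⟨ cong₂ _*F_ xᴺ≡1 (^-*-≡1 {x} {N} xᴺ≡1 c) ⟩
    1F *F 1F                        ≡⟨ *-identityˡ 1F ⟩
    1F                              ∎

  ^-periodic : ∀ {x N} → x ^F N ≡ 1F → ∀ a c → x ^F (a + N * c) ≡ x ^F a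
  ^-periodic {x} {N} xᴺ≡1 a c = begin
    x ^F (a + N * c)                ≡⟨ ^-+ x a (N * c) ⟩
    x ^F a *F x ^F (N * c)          ≡⟨ cong (x ^F a *F_) (^-*-≡1 {x} {N} xᴺ≡1 c) ⟩
    x ^F a *F 1F                    ≡⟨ *-identityʳ _ ⟩
    x ^F a                          ∎

  ^-% : ∀ {x N} .{{_ : NonZero N}} → x ^F N ≡ 1F → ∀ a → x ^F a ≡ x ^F (a % N)
  ^-% {x} {N} xᴺ≡1 a = begin
    x ^F a                          ≡⟨ cong (x ^F_) (m≡m%n+[m/n]*n a N) ⟩
    x ^F (a % N + a / N * N)        ≡⟨ cong (λ e → x ^F (a % N + e)) (ℕ.*-comm (a / N) N) ⟩
    x ^F (a % N + N * (a / N))      ≡⟨ ^-periodic {x} {N} xᴺ≡1 (a % N) (a / N) ⟩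
    x ^F (a % N)                    ∎

  sumF-*ˡ : ∀ {n} u (f : Fin n → F) → sumF (λ l → u *F f l) ≡ u *F sumF f
  sumF-*ˡ {zero}  u f = sym (zeroʳ u)
  sumF-*ˡ {suc n} u f =
    trans (cong (u *F f Fin.zero +F_) (sumF-*ˡ u (f ∘ Fin.suc))) (sym (distribˡ _ _ _))

  partialSum-*ˡ : ∀ {n} u (f : Fin n → F) l → partialSum (λ l → u *F f l) l ≡ u *F partialSum f l
  partialSum-*ˡ {suc n} u f Fin.zero    = refl
  partialSum-*ˡ {suc n} u f (Fin.suc l) =
    trans (cong (u *F f Fin.zero +F_) (partialSum-*ˡ u (f ∘ Fin.suc) l)) (sym (distribˡ _ _ _))

-- Primitivity only says that g generates F∖{0}; its order q − 1 is recovered by counting: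
-- for the least period ord of g, the powers g^e (e < ord) are distinct and with 0 exhaust F.
module PrimitiveElement {q : ℕ} (𝔽 : FiniteField q) {g : FiniteField.F 𝔽} (prim : FF.Primitive 𝔽 g) where
  open FF 𝔽
  open FieldProperties 𝔽
  open IsCommutativeRing isCommRing using (*-identityʳ)
  open ≡-Reasoning

  g≢0 : g ≢ 0F
  g≢0 = proj₁ prim

  log : ∀ x → x ≢ 0F → ℕ
  log x x≢0 = proj₁ (proj₂ prim x x≢0)

  g^log : ∀ x (x≢0 : x ≢ 0F) → g ^F log x x≢0 ≡ x
  g^log x x≢0 = proj₂ (proj₂ prim x x≢0)

  private
    minimalPeriod : Σ ℕ λ d → g ^F suc d ≡ 1F × (∀ {e} → e < d → g ^F suc e ≢ 1F)
    minimalPeriod =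
      let (i , ¬Pi , Psmaller) = Fin.¬∀⟶∃¬-smallest (suc n) P (λ i → ¬? (_ ≟ _)) ¬∀P
      in toℕ i , decidable-stable (_ ≟ _) ¬Pi ,
         λ {e} e<i → subst (λ e → g ^F suc e ≢ 1F)
                       (trans (Fin.toℕ-inject (fromℕ< e<i)) (Fin.toℕ-fromℕ< e<i))
                       (Psmaller (fromℕ< e<i))
      where
      n = log (g ⁻¹) (x⁻¹≢0 g≢0)
      P : Fin (suc n) → Set
      P i = g ^F suc (toℕ i) ≢ 1F
      ¬∀P : ¬ (∀ i → P i)
      ¬∀P ∀P = ∀P (Fin.fromℕ n)
        (subst (λ e → g ^F suc e ≡ 1F) (sym (Fin.toℕ-fromℕ n))
               (trans (cong (g *F_) (g^log _ _)) (inverseʳ g g≢0)))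

    ord : ℕ
    ord = suc (proj₁ minimalPeriod)

    g^ord≡1 : g ^F ord ≡ 1F
    g^ord≡1 = proj₁ (proj₂ minimalPeriod)

    g^a≢g^b : ∀ {a b} → a < b → b < ord → g ^F a ≢ g ^F b
    g^a≢g^b {a} a<b b<ord gᵃ≡gᵇ with ℕ.m≤n⇒∃[o]m+o≡n a<b
    ... | o , refl = proj₂ (proj₂ minimalPeriod) o<d (sym (*-cancelˡ (^≢0 g≢0 a) (begin
        g ^F a *F 1F            ≡⟨ *-identityʳ _ ⟩
        g ^F a                  ≡⟨ gᵃ≡gᵇ ⟩
        g ^F suc (a + o)        ≡⟨ cong (g ^F_) (ℕ.+-suc a o) ⟨
        g ^F (a + suc o)        ≡⟨ ^-+ g a (suc o) ⟩
        g ^F a *F g ^F suc o    ∎)))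
      where o<d = ℕ.≤-trans (s≤s (ℕ.m≤n+m o a)) (ℕ.≤-pred b<ord)

    ^-injective-<ord : ∀ {a b} → a < ord → b < ord → g ^F a ≡ g ^F b → a ≡ b
    ^-injective-<ord {a} {b} a<ord b<ord gᵃ≡gᵇ with ℕ.<-cmp a b
    ... | tri< a<b _ _ = ⊥-elim (g^a≢g^b a<b b<ord gᵃ≡gᵇ)
    ... | tri≈ _ a≡b _ = a≡b
    ... | tri> _ _ b<a = ⊥-elim (g^a≢g^b b<a a<ord (sym gᵃ≡gᵇ))

    zeroOrPower : Fin (suc ord) → F
    zeroOrPower Fin.zero    = 0F
    zeroOrPower (Fin.suc i) = g ^F toℕ i

    zeroOrPower-injective : Injective _≡_ _≡_ zeroOrPower
    zeroOrPower-injective {Fin.zero}  {Fin.zero}  _     = refl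
    zeroOrPower-injective {Fin.zero}  {Fin.suc j} 0≡gʲ  = ⊥-elim (^≢0 g≢0 (toℕ j) (sym 0≡gʲ))
    zeroOrPower-injective {Fin.suc i} {Fin.zero}  gⁱ≡0  = ⊥-elim (^≢0 g≢0 (toℕ i) gⁱ≡0)
    zeroOrPower-injective {Fin.suc i} {Fin.suc j} gⁱ≡gʲ =
      cong Fin.suc (Fin.toℕ-injective (^-injective-<ord (Fin.toℕ<n i) (Fin.toℕ<n j) gⁱ≡gʲ))

    position : ∀ x → Dec (x ≡ 0F) → Fin (suc ord)
    position x (yes _)   = Fin.zero
    position x (no x≢0)  = Fin.suc (fromℕ< (m%n<n (log x x≢0) ord))

    position-injective : ∀ {x y} x≟0 y≟0 → position x x≟0 ≡ position y y≟0 → x ≡ y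
    position-injective (yes x≡0) (yes y≡0) _  = trans x≡0 (sym y≡0)
    position-injective {x} {y} (no x≢0) (no y≢0) eq = begin
      x                        ≡⟨ g^log x x≢0 ⟨
      g ^F log x x≢0           ≡⟨ ^-% {g} {ord} g^ord≡1 (log x x≢0) ⟩
      g ^F (log x x≢0 % ord)   ≡⟨ cong (g ^F_) (Fin.fromℕ<-injective _ _ _ _ (Fin.suc-injective eq)) ⟩
      g ^F (log y y≢0 % ord)   ≡⟨ ^-% {g} {ord} g^ord≡1 (log y y≢0) ⟨
      g ^F log y y≢0           ≡⟨ g^log y y≢0 ⟩
      y                        ∎

    q≡1+ord : q ≡ suc ord
    q≡1+ord = ℕ.≤-antisym
      (Fin.injective⇒≤ {f = λ i → position (Inverse.to enum i) (Inverse.to enum i ≟ 0F)}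
        (λ eq → Injection.injective (↔⇒↣ enum) (position-injective _ _ eq)))
      (Fin.injective⇒≤ {f = Inverse.from enum ∘ zeroOrPower}
        (λ eq → zeroOrPower-injective (Injection.injective (↔⇒↣ (↔-sym enum)) eq)))

  module _ {N : ℕ} (q≡1+N : q ≡ suc N) where
    private
      ord≡N : ord ≡ N
      ord≡N = ℕ.suc-injective (trans (sym q≡1+ord) q≡1+N)

    ^-order : g ^F N ≡ 1F
    ^-order = subst (λ n → g ^F n ≡ 1F) ord≡N g^ord≡1

    ^-injective : ∀ {a b} → a < N → b < N → g ^F a ≡ g ^F b → a ≡ b
    ^-injective {a} {b} a<N b<N =
      ^-injective-<ord (subst (a <_) (sym ord≡N) a<N) (subst (b <_) (sym ord≡N) b<N)

    ^-≡⇒%-≡ : ∀ {n a b} .{{_ : NonZero n}} → n ∣ N → g ^F a ≡ g ^F b → a % n ≡ b % n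
    ^-≡⇒%-≡ {n} {a} {b} n∣N gᵃ≡gᵇ = begin
      a % n           ≡⟨ m∣n⇒o%n%m≡o%m n ord a n∣ord ⟨
      a % ord % n     ≡⟨ cong (_% n) (^-injective-<ord (m%n<n a ord) (m%n<n b ord) gᵃ%≡gᵇ%) ⟩
      b % ord % n     ≡⟨ m∣n⇒o%n%m≡o%m n ord b n∣ord ⟩
      b % n           ∎
      where
      n∣ord = subst (n ∣_) (sym ord≡N) n∣N
      gᵃ%≡gᵇ% = trans (sym (^-% {g} {ord} g^ord≡1 a)) (trans gᵃ≡gᵇ (^-% {g} {ord} g^ord≡1 b))

module CyclotomicConstruction (k′ t : ℕ) where
  k m : ℕ
  k = suc k′
  m = suc (2 * t)

  module _ {q : ℕ} (𝔽 : FiniteField q) {g : FiniteField.F 𝔽} (prim : FF.Primitive 𝔽 g)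
           (q≡1+2km : q ≡ suc (2 * k * m)) where
    open FF 𝔽
    open FieldProperties 𝔽
    open PrimitiveElement 𝔽 prim
    open IsCommutativeRing isCommRing using (zeroʳ)
    open RingProperties (CommutativeRing.ring commutativeRing) using (-1*x≈-x)
    open ≡-Reasoning

    g^-periodic : ∀ a c → g ^F (a + 2 * k * m * c) ≡ g ^F a
    g^-periodic = ^-periodic {g} {2 * k * m} (^-order q≡1+2km)

    g^km≡-1 : g ^F (k * m) ≡ -F 1F
    g^km≡-1 = x²≡1⇒x≡-1 g^km*g^km≡1 g^km≢1
      where
      km+km≡2km : ∀ k m → k * m + k * m ≡ 2 * k * m
      km+km≡2km = solve-∀
      g^km*g^km≡1 : g ^F (k * m) *F g ^F (k * m) ≡ 1F
      g^km*g^km≡1 = begin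
        g ^F (k * m) *F g ^F (k * m)   ≡⟨ ^-+ g (k * m) (k * m) ⟨
        g ^F (k * m + k * m)           ≡⟨ cong (g ^F_) (km+km≡2km k m) ⟩
        g ^F (2 * k * m)               ≡⟨ ^-order q≡1+2km ⟩
        1F                             ∎
      km<2km : k * m < 2 * k * m
      km<2km = subst (k * m <_) (km+km≡2km k m) (ℕ.m<m+n (k * m) (s≤s z≤n))
      g^km≢1 : g ^F (k * m) ≢ 1F
      g^km≢1 g^km≡1 = ℕ.1+n≢0 (^-injective q≡1+2km km<2km (ℕ.≤-trans (s≤s z≤n) km<2km) g^km≡1)

    -x≡g^km*x : ∀ x → -F x ≡ g ^F (k * m) *F x
    -x≡g^km*x x = trans (sym (-1*x≈-x x)) (cong (_*F x) (sym g^km≡-1))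

    shift : Bool → ℕ
    shift true  = k
    shift false = 0

    -- km = k + 2kt, so negation adds k to the exponent modulo 2k.
    sign-^ : ∀ b i s → Σ ℕ λ s′ → sign b (g ^F (i + 2 * k * s)) ≡ g ^F ((i + shift b) + s′ * (2 * k))
    sign-^ false i s = s , cong (g ^F_) (reorder i k s)
      where
      reorder : ∀ i k s → i + 2 * k * s ≡ (i + 0) + s * (2 * k)
      reorder = solve-∀
    sign-^ true i s = s + t , (begin
      -F (g ^F (i + 2 * k * s))             ≡⟨ -x≡g^km*x _ ⟩
      g ^F (k * m) *F g ^F (i + 2 * k * s)  ≡⟨ ^-+ g (k * m) _ ⟨
      g ^F (k * m + (i + 2 * k * s))        ≡⟨ cong (g ^F_) (reorder i k s t) ⟩
      g ^F ((i + k) + (s + t) * (2 * k))    ∎)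
      where
      reorder : ∀ i k s t → k * suc (2 * t) + (i + 2 * k * s) ≡ (i + k) + (s + t) * (2 * k)
      reorder = solve-∀

    shift-class : ∀ (i : Fin k) b s → ((toℕ i + shift b) + s * (2 * k)) % (2 * k) ≡ toℕ i + shift b
    shift-class i b s = trans ([m+kn]%n≡m%n (toℕ i + shift b) s (2 * k)) (m<n⇒m%n≡m i+shift<2k)
      where
      shift≤k : ∀ b → shift b ≤ k
      shift≤k true  = ℕ.≤-refl
      shift≤k false = z≤n
      i+shift<2k : toℕ i + shift b < 2 * k
      i+shift<2k = subst (toℕ i + shift b <_) (cong (k +_) (sym (ℕ.+-identityʳ k)))
                         (ℕ.+-mono-<-≤ (Fin.toℕ<n i) (shift≤k b))

    i+k≢j+0 : ∀ (i j : Fin k) → toℕ i + k ≢ toℕ j + 0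
    i+k≢j+0 i j eq = ℕ.<⇒≱ (Fin.toℕ<n j) (subst (k ≤_) (trans eq (ℕ.+-identityʳ _)) (ℕ.m≤n+m k (toℕ i)))

    shift-injective : ∀ {i j : Fin k} b c → toℕ i + shift b ≡ toℕ j + shift c → i ≡ j × b ≡ c
    shift-injective         false false eq = Fin.toℕ-injective (ℕ.+-cancelʳ-≡ 0 _ _ eq) , refl
    shift-injective         true  true  eq = Fin.toℕ-injective (ℕ.+-cancelʳ-≡ k _ _ eq) , refl
    shift-injective {i} {j} true  false eq = ⊥-elim (i+k≢j+0 i j eq)
    shift-injective {i} {j} false true  eq = ⊥-elim (i+k≢j+0 j i (sym eq))

    sign-class : ∀ {i j : Fin k} {s s′} b c →
                 sign b (g ^F (toℕ i + 2 * k * s)) ≡ sign c (g ^F (toℕ j + 2 * k * s′)) → i ≡ j × b ≡ c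
    sign-class {i} {j} {s} {s′} b c eq =
      let (e , gᵉ) = sign-^ b (toℕ i) s
          (e′ , gᵉ′) = sign-^ c (toℕ j) s′
          a = (toℕ i + shift b) + e * (2 * k)
          a′ = (toℕ j + shift c) + e′ * (2 * k)
      in shift-injective b c (begin
        toℕ i + shift b                              ≡⟨ shift-class i b e ⟨
        a % (2 * k)                                  ≡⟨ ^-≡⇒%-≡ q≡1+2km {2 * k} {a} {a′} (m∣m*n m) (trans (sym gᵉ) (trans eq gᵉ′)) ⟩
        a′ % (2 * k)                                 ≡⟨ shift-class j c e′ ⟩
        toℕ j + shift c                              ∎)

    g^[n%2k+2k*[n/2k]] : ∀ n → g ^F n ≡ g ^F (n % (2 * k) + 2 * k * (n / (2 * k)))
    g^[n%2k+2k*[n/2k]] n = cong (g ^F_) (trans (m≡m%n+[m/n]*n n (2 * k)) (cong (n % (2 * k) +_) (ℕ.*-comm _ (2 * k))))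

    In±C : F → Set
    In±C x = Σ (Fin k) λ i → Σ ℕ λ s → Σ Bool λ b → x ≡ sign b (g ^F (toℕ i + 2 * k * s))

    power-In±C : ∀ n → In±C (g ^F n)
    power-In±C n with n % (2 * k) ℕ.<? k
    ... | yes c<k = fromℕ< c<k , s , false , (begin
      g ^F n                                   ≡⟨ g^[n%2k+2k*[n/2k]] n ⟩
      g ^F (n % (2 * k) + 2 * k * s)           ≡⟨ cong (λ c → g ^F (c + 2 * k * s)) (Fin.toℕ-fromℕ< c<k) ⟨
      g ^F (toℕ (fromℕ< c<k) + 2 * k * s)      ∎)
      where s = n / (2 * k)
    ... | no c≮k =
      let (o , k+o≡c) = ℕ.m≤n⇒∃[o]m+o≡n (ℕ.≮⇒≥ c≮k)
          o<k = ℕ.+-cancelˡ-< k o k (subst (_< k + k) (sym k+o≡c) c<k+k)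
      in fromℕ< o<k , s + suc t , true , (begin
      g ^F n                                          ≡⟨ g^[n%2k+2k*[n/2k]] n ⟩
      g ^F (n % (2 * k) + 2 * k * s)                  ≡⟨ cong (λ c → g ^F (c + 2 * k * s)) k+o≡c ⟨
      g ^F ((k + o) + 2 * k * s)                      ≡⟨ g^-periodic ((k + o) + 2 * k * s) 1 ⟨
      g ^F ((k + o) + 2 * k * s + 2 * k * m * 1)      ≡⟨ cong (g ^F_) (reorder k t o s) ⟩
      g ^F (k * m + (o + 2 * k * (s + suc t)))        ≡⟨ ^-+ g (k * m) _ ⟩
      g ^F (k * m) *F g ^F (o + 2 * k * (s + suc t))  ≡⟨ -x≡g^km*x _ ⟨
      -F (g ^F (o + 2 * k * (s + suc t)))             ≡⟨ cong (λ i → -F (g ^F (i + 2 * k * (s + suc t)))) (Fin.toℕ-fromℕ< o<k) ⟨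
      -F (g ^F (toℕ (fromℕ< o<k) + 2 * k * (s + suc t))) ∎)
      where
      s = n / (2 * k)
      c<k+k : n % (2 * k) < k + k
      c<k+k = subst (n % (2 * k) <_) (cong (k +_) (ℕ.+-identityʳ k)) (m%n<n n (2 * k))
      reorder : ∀ k t o s → (k + o) + 2 * k * s + 2 * k * suc (2 * t) * 1 ≡ k * suc (2 * t) + (o + 2 * k * (s + suc t))
      reorder = solve-∀

    nonzero-In±C : ∀ x → x ≢ 0F → In±C x
    nonzero-In±C x x≢0 = subst In±C (g^log x x≢0) (power-In±C (log x x≢0))

    ^2k-injective : ∀ {s s′} → s < m → s′ < m → g ^F (2 * k * s) ≡ g ^F (2 * k * s′) → s ≡ s′
    ^2k-injective {s} {s′} s<m s′<m eq = ℕ.*-cancelˡ-≡ s s′ (2 * k)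
      (^-injective q≡1+2km (ℕ.*-monoʳ-< (2 * k) s<m) (ℕ.*-monoʳ-< (2 * k) s′<m) eq)

    module _ (α : Fin k → Bool) where
      point : Fin k → ℕ → F
      point i s = sign (α i) (g ^F (toℕ i + 2 * k * s))

      point≢0 : ∀ i s → point i s ≢ 0F
      point≢0 i s = sign≢0 (α i) (^≢0 g≢0 (toℕ i + 2 * k * s))

      point-class : ∀ {i j s s′} → point i s ≡ point j s′ → i ≡ j
      point-class {i} {j} eq = proj₁ (sign-class (α i) (α j) eq)

      point≢-point : ∀ i j s s′ → point i s ≢ -F point j s′
      point≢-point i j s s′ eq =
        let (i≡j , αi≡¬αj) = sign-class {i} {j} (α i) (not (α j)) (trans eq (-‿sign (α j) _))
        in not-¬ (cong α i≡j) αi≡¬αj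

      point-injective : ∀ {i j s s′} → s < m → s′ < m → point i s ≡ point j s′ → s ≡ s′
      point-injective {i} {j} {s} {s′} s<m s′<m eq = ^2k-injective s<m s′<m (*-cancelˡ (^≢0 g≢0 (toℕ i))
        (trans (sym (^-+ g (toℕ i) _)) (trans (sign-injective (α i) eq′) (^-+ g (toℕ i) _))))
        where eq′ = subst (λ j → point i s ≡ point j s′) (sym (point-class eq)) eq

      point-periodic : ∀ i s c → point i (s + m * c) ≡ point i s
      point-periodic i s c = cong (sign (α i)) (begin
        g ^F (toℕ i + 2 * k * (s + m * c))        ≡⟨ cong (g ^F_) (reorder (toℕ i) k m s c) ⟩
        g ^F ((toℕ i + 2 * k * s) + 2 * k * m * c) ≡⟨ g^-periodic (toℕ i + 2 * k * s) c ⟩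
        g ^F (toℕ i + 2 * k * s)                  ∎)
        where
        reorder : ∀ i k m s c → i + 2 * k * (s + m * c) ≡ (i + 2 * k * s) + 2 * k * m * c
        reorder = solve-∀

      point-%-+ : ∀ i s u → point i (s % m + u) ≡ point i (s + u)
      point-%-+ i s u = begin
        point i (s % m + u)                ≡⟨ point-periodic i (s % m + u) (s / m) ⟨
        point i (s % m + u + m * (s / m))  ≡⟨ cong (point i) (reorder (s % m) u m (s / m)) ⟩
        point i (s % m + s / m * m + u)    ≡⟨ cong (λ s → point i (s + u)) (m≡m%n+[m/n]*n s m) ⟨
        point i (s + u)                    ∎
        where
        reorder : ∀ r u m d → r + u + m * d ≡ r + d * m + u
        reorder = solve-∀

      ^2k*point : ∀ j i s → g ^F (2 * k * j) *F point i s ≡ point i (j + s)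
      ^2k*point j i s = begin
        g ^F (2 * k * j) *F point i s                               ≡⟨ *-sign (α i) _ _ ⟩
        sign (α i) (g ^F (2 * k * j) *F g ^F (toℕ i + 2 * k * s))   ≡⟨ cong (sign (α i)) (^-+ g (2 * k * j) (toℕ i + 2 * k * s)) ⟨
        sign (α i) (g ^F (2 * k * j + (toℕ i + 2 * k * s)))         ≡⟨ cong (λ e → sign (α i) (g ^F e)) (reorder k j (toℕ i) s) ⟩
        point i (j + s)                                             ∎
        where
        reorder : ∀ k j i s → 2 * k * j + (i + 2 * k * s) ≡ i + 2 * k * (j + s)
        reorder = solve-∀

      point-% : ∀ i s → point i (s % m) ≡ point i s
      point-% i s = begin
        point i (s % m)       ≡⟨ cong (point i) (ℕ.+-identityʳ (s % m)) ⟨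
        point i (s % m + 0)   ≡⟨ point-%-+ i s 0 ⟩
        point i (s + 0)       ≡⟨ cong (point i) (ℕ.+-identityʳ s) ⟩
        point i s             ∎

      pointAt : Fin k × Fin m → F
      pointAt (i , j) = point i (toℕ j)

      pointAt-injective : Injective _≡_ _≡_ pointAt
      pointAt-injective {i , j} {i′ , j′} eq =
        cong₂ _,_ (point-class eq) (Fin.toℕ-injective (point-injective (Fin.toℕ<n j) (Fin.toℕ<n j′) eq))

      pts : Fin (k * m) → F
      pts = pointAt ∘ Fin.remQuot m

      pts-injective : Injective _≡_ _≡_ pts
      pts-injective eq = Injection.injective (↔⇒↣ Fin.*↔×) (pointAt-injective eq)

      pointIndex : Fin k → ℕ → Fin (k * m)
      pointIndex i s = Fin.combine i (fromℕ< (m%n<n s m))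

      pts-pointIndex : ∀ i s → pts (pointIndex i s) ≡ point i s
      pts-pointIndex i s = begin
        pointAt (Fin.remQuot m (pointIndex i s))  ≡⟨ cong pointAt (Fin.remQuot-combine i _) ⟩
        point i (toℕ (fromℕ< (m%n<n s m)))        ≡⟨ cong (point i) (Fin.toℕ-fromℕ< (m%n<n s m)) ⟩
        point i (s % m)                           ≡⟨ point-% i s ⟩
        point i s                                 ∎

      pts-cover : ∀ x → x ≢ 0F → (Σ (Fin (k * m)) λ a → pts a ≡ x) ⊎ (Σ (Fin (k * m)) λ a → pts a ≡ -F x)
      pts-cover x x≢0 =
        let (i , s , b , x≡±gᵉ) = nonzero-In±C x x≢0
        in Sum.map (λ p≡x → pointIndex i s , trans (pts-pointIndex i s) (trans p≡x (sym x≡±gᵉ)))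
                   (λ p≡-x → pointIndex i s , trans (pts-pointIndex i s) (trans p≡-x (cong -F_ (sym x≡±gᵉ))))
                   (sign-cases b (α i) (g ^F (toℕ i + 2 * k * s)))

      module FromHDM {r : ℕ} (M : HDM g k α r) where
        open HDM M using (B; inCol; ratios) renaming (zeroSum to rowSum)

        exponent : Fin r → Fin k → ℕ
        exponent h l = proj₁ (proj₁ (proj₂ (inCol h l)))

        B≡point : ∀ h l → B h l ≡ point l (exponent h l)
        B≡point h l = let (_ , (_ , y≡gᵉ) , B≡±y) = inCol h l in trans B≡±y (cong (sign (α l)) y≡gᵉ)

        B≢0 : ∀ h l → B h l ≢ 0F
        B≢0 h l B≡0 = point≢0 l (exponent h l) (trans (sym (B≡point h l)) B≡0)

        blk : Fin r → Fin m → Fin k → F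
        blk h j l = g ^F (2 * k * toℕ j) *F B h l

        blk≡point : ∀ h j l → blk h j l ≡ point l (toℕ j + exponent h l)
        blk≡point h j l = trans (cong (g ^F (2 * k * toℕ j) *F_) (B≡point h l)) (^2k*point (toℕ j) l _)

        blk-column : ∀ h j l h′ j′ l′ → blk h j l ≡ blk h′ j′ l′ → l ≡ l′
        blk-column h j l h′ j′ l′ eq =
          point-class (trans (sym (blk≡point h j l)) (trans eq (blk≡point h′ j′ l′)))

        blk-translate-injective : ∀ h j j′ l → blk h j l ≡ blk h j′ l → j ≡ j′
        blk-translate-injective h j j′ l eq =
          Fin.toℕ-injective (^2k-injective (Fin.toℕ<n j) (Fin.toℕ<n j′) (*-cancelʳ (B≢0 h l) eq))

        blk-align : ∀ h j l h′ j′ l′ → blk h j l ≡ blk h′ j′ l′ → blk h j l ≡ blk h′ j′ l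
        blk-align h j l h′ j′ l′ eq = trans eq (cong (blk h′ j′) (sym (blk-column h j l h′ j′ l′ eq)))

        blk-disjoint : ∀ h j j′ l l′ → blk h j l ≡ blk h j′ l′ → j ≡ j′
        blk-disjoint h j j′ l l′ eq = blk-translate-injective h j j′ l (blk-align h j l h j′ l′ eq)

        same-ratio : ∀ h h′ j j′ l l′ → blk h j l ≡ blk h′ j′ l → blk h j l′ ≡ blk h′ j′ l′ →
                     B h l *F B h l′ ⁻¹ ≡ B h′ l *F B h′ l′ ⁻¹
        same-ratio h h′ j j′ l l′ eq eq′ = begin
          B h l *F B h l′ ⁻¹              ≡⟨ ratio-*ˡ (^≢0 g≢0 (2 * k * toℕ j)) (B≢0 h l′) ⟨
          blk h j l *F blk h j l′ ⁻¹      ≡⟨ cong₂ (λ x y → x *F y ⁻¹) eq eq′ ⟩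
          blk h′ j′ l *F blk h′ j′ l′ ⁻¹  ≡⟨ ratio-*ˡ (^≢0 g≢0 (2 * k * toℕ j′)) (B≢0 h′ l′) ⟩
          B h′ l *F B h′ l′ ⁻¹            ∎

        blk-row : ∀ h h′ j j′ {l l′} → l ≢ l′ → blk h j l ≡ blk h′ j′ l → blk h j l′ ≡ blk h′ j′ l′ → h ≡ h′
        blk-row h h′ j j′ {l} {l′} l≢l′ eq eq′ with h Fin.≟ h′ | ℕ.<-cmp (toℕ l) (toℕ l′)
        ... | yes h≡h′ | _            = h≡h′
        ... | no h≢h′  | tri< l<l′ _ _ = ⊥-elim (ratios l l′ l<l′ h h′ h≢h′ (same-ratio h h′ j j′ l l′ eq eq′))
        ... | no h≢h′  | tri≈ _ l≡l′ _ = ⊥-elim (l≢l′ (Fin.toℕ-injective l≡l′))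
        ... | no h≢h′  | tri> _ _ l′<l = ⊥-elim (ratios l′ l l′<l h h′ h≢h′ (same-ratio h h′ j j′ l′ l eq′ eq))

        blocks-meet-once : ∀ c j c′ j′ → ¬ (c ≡ c′ × j ≡ j′) → ∀ x y → x ≢ y →
                           ¬ ((Σ (Fin k) λ l → blk c j l ≡ x) × (Σ (Fin k) λ l → blk c j l ≡ y) ×
                              (Σ (Fin k) λ l → blk c′ j′ l ≡ x) × (Σ (Fin k) λ l → blk c′ j′ l ≡ y))
        blocks-meet-once c j c′ j′ ≢block x y x≢y ((l₁ , e₁) , (l₂ , e₂) , (l₁′ , e₁′) , (l₂′ , e₂′)) =
          ≢block (c≡c′ , blk-translate-injective c j j′ l₁ (subst (λ c′ → blk c j l₁ ≡ blk c′ j′ l₁) (sym c≡c′) e₁″))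
          where
          l₁≢l₂ : l₁ ≢ l₂
          l₁≢l₂ l₁≡l₂ = x≢y (trans (sym e₁) (trans (cong (blk c j) l₁≡l₂) e₂))
          e₁″ : blk c j l₁ ≡ blk c′ j′ l₁
          e₁″ = blk-align c j l₁ c′ j′ l₁′ (trans e₁ (sym e₁′))
          e₂″ : blk c j l₂ ≡ blk c′ j′ l₂
          e₂″ = blk-align c j l₂ c′ j′ l₂′ (trans e₂ (sym e₂′))
          c≡c′ : c ≡ c′
          c≡c′ = blk-row c c′ j j′ l₁≢l₂ e₁″ e₂″

        blk-cover : ∀ h a → Σ (Fin m) λ j → Σ (Fin k) λ l → blk h j l ≡ pts a
        blk-cover h a =
          let (i , j₀) = Fin.remQuot m a
              e = exponent h i
              j = fromℕ< (m%n<n (toℕ j₀ + 2 * t * e) m)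
          in j , i , (begin
            -- j + e ≡ j₀ modulo m, because 2t + 1 = m
            blk h j i                              ≡⟨ blk≡point h j i ⟩
            point i (toℕ j + e)                    ≡⟨ cong (λ s → point i (s + e)) (Fin.toℕ-fromℕ< (m%n<n (toℕ j₀ + 2 * t * e) m)) ⟩
            point i ((toℕ j₀ + 2 * t * e) % m + e) ≡⟨ point-%-+ i (toℕ j₀ + 2 * t * e) e ⟩
            point i (toℕ j₀ + 2 * t * e + e)       ≡⟨ cong (point i) (reorder (toℕ j₀) t e) ⟩
            point i (toℕ j₀ + m * e)               ≡⟨ point-periodic i (toℕ j₀) e ⟩
            point i (toℕ j₀)                       ∎)
          where
          reorder : ∀ j t e → j + 2 * t * e + e ≡ j + suc (2 * t) * e
          reorder = solve-∀

        blk-zeroSum : ∀ h j → sumF (blk h j) ≡ 0F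
        blk-zeroSum h j = begin
          sumF (blk h j)                          ≡⟨ sumF-*ˡ (g ^F (2 * k * toℕ j)) (B h) ⟩
          g ^F (2 * k * toℕ j) *F sumF (B h)      ≡⟨ cong (g ^F (2 * k * toℕ j) *F_) (rowSum h) ⟩
          g ^F (2 * k * toℕ j) *F 0F              ≡⟨ zeroʳ _ ⟩
          0F                                      ∎

        heffterSpace : HeffterSpace (k * m) k r
        heffterSpace = record
          { pts       = pts
          ; pts-inj   = pts-injective
          ; half-0    = λ _ → point≢0 _ _
          ; half-cov  = pts-cover
          ; half-disj = λ _ _ → point≢-point _ _ _ _
          ; m         = m
          ; blk       = blk
          ; blk-pt    = λ h j l → pointIndex l (toℕ j + exponent h l) ,
                                  trans (pts-pointIndex l (toℕ j + exponent h l)) (sym (blk≡point h j l))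
          ; blk-inj   = λ h j {l} {l′} → blk-column h j l h j l′
          ; cls-cov   = blk-cover
          ; cls-disj  = blk-disjoint
          ; config    = blocks-meet-once
          ; zeroSum   = blk-zeroSum
          }

        heffterSpace-simple : SimpleHDM M → SimpleHS heffterSpace
        heffterSpace-simple simple h j = ↔-id (Fin k) , λ {l} {l′} eq →
          simple h (*-cancelˡ (^≢0 g≢0 (2 * k * toℕ j))
            (trans (sym (partialSum-*ˡ _ (B h) l)) (trans eq (partialSum-*ˡ _ (B h) l′))))

4kt+2k+1≡1+2k[2t+1] : ∀ k t → t * (4 * k) + (2 * k + 1) ≡ suc (2 * k * suc (2 * t))
4kt+2k+1≡1+2k[2t+1] = solve-∀

2km/2≡km : ∀ k m → 2 * k * m / 2 ≡ k * m
2km/2≡km k m = trans (cong (_/ 2) (2km≡km*2 k m)) (m*n/n≡m (k * m) 2)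
  where
  2km≡km*2 : ∀ k m → 2 * k * m ≡ k * m * 2
  2km≡km*2 = solve-∀

theorem2p2 : (k : ℕ) → 1 ≤ k → (q : ℕ) → IsPrimePower q →
    (Σ ℕ λ t → q ≡ t * (4 * k) + (2 * k + 1)) →
    (𝔽 : FiniteField q) → (g : FiniteField.F 𝔽) → FF.Primitive 𝔽 g →
    (α : Fin k → Bool) → (∀ i → toℕ i ≡ 0 → α i ≡ false) →
    (r : ℕ) →
    (FF.HDM 𝔽 g k α r → FF.HeffterSpace 𝔽 ((q ∸ 1) / 2) k r) ×
    ((Σ (FF.HDM 𝔽 g k α r) (FF.SimpleHDM 𝔽)) →
      Σ (FF.HeffterSpace 𝔽 ((q ∸ 1) / 2) k r) (FF.SimpleHS 𝔽))
theorem2p2 zero    ()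
theorem2p2 (suc k′) _ q _ (t , q≡4kt+2k+1) 𝔽 g prim α _ r =
  (λ M → subst (λ v → HeffterSpace v k r) (sym v≡km) (heffterSpace M)) ,
  (λ (M , simple) → subst (λ v → Σ (HeffterSpace v k r) SimpleHS) (sym v≡km)
                          (heffterSpace M , heffterSpace-simple M simple))
  where
  open FF 𝔽
  open CyclotomicConstruction k′ t
  q≡1+2km : q ≡ suc (2 * k * m)
  q≡1+2km = trans q≡4kt+2k+1 (4kt+2k+1≡1+2k[2t+1] k t)
  v≡km : (q ∸ 1) / 2 ≡ k * m
  v≡km = trans (cong (λ q → (q ∸ 1) / 2) q≡1+2km) (2km/2≡km k m)
  open FromHDM 𝔽 prim q≡1+2km α
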